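{- For every integer $m$ there exists a finite tournament whose inversion index is greater than $m$.
   Context: For a tournament $T$ and $X\subseteq V(T)$, $\mathrm{Inv}(T,X)$ is obtained by reversing all arcs with both ends in $X$. For a finite sequence $(X_i)_{i<k}$ of subsets of $V(T)$, $\mathrm{Inv}(T,(X_i)_{i<k})$ reverses an arc $(x,y)$ iff the number of $i$ with $\{x,y\}\subseteq X_i$ is odd. The inversion index $i(T)$ is the least integer $k$ for which there is a sequence $(X_i)_{i<k}$ with $\mathrm{Inv}(T,(X_i)_{i<k})$ acyclic. -}

module Defs where

open import Data.Nat using (ℕ) renaming (zero to nzero; suc to nsuc)
open import Data.Bool using (Bool; true; false; not; _xor_; _∧_; _∨_; T)
open import Data.Fin using (Fin; zero; suc)
open import Data.Fin.Subset using (Subset)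
open import Data.Vec using (lookup)
open import Data.Product using (Σ; ∃; _×_)
open import Relation.Nullary using (¬_)
open import Relation.Binary.PropositionalEquality using (_≡_; _≢_)
open import Relation.Binary.Construct.Closure.Transitive using (TransClosure)

record Tournament (n : ℕ) : Set where
  field
    arc     : Fin n → Fin n → Bool
    loopless : ∀ x → arc x x ≡ false
    oneArc  : ∀ x y → x ≢ y → arc x y ≡ not (arc y x)
open Tournament public

oddCount : ∀ {n} (k : ℕ) → (Fin k → Subset n) → Fin n → Fin n → Bool
oddCount nzero    X x y = false
oddCount (nsuc k) X x y =
  (lookup (X zero) x ∧ lookup (X zero) y) xor oddCount k (λ i → X (suc i)) x y

-- Arc relation of Inv(T, (X i)_{i<k}): the arc (x , y) of T is kept if the
-- number of i with {x , y} ⊆ X i is even, and reversed (becoming (y , x)) if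
-- it is odd.
invArc : ∀ {n} → Tournament n → (k : ℕ) → (Fin k → Subset n) → Fin n → Fin n → Set
invArc T' k X x y =
  T ((arc T' x y ∧ not (oddCount k X x y)) ∨ (arc T' y x ∧ oddCount k X y x))

Acyclic : ∀ {n} → (Fin n → Fin n → Set) → Set
Acyclic {n} R = (x : Fin n) → ¬ TransClosure R x x

InvertibleWith : ∀ {n} → Tournament n → ℕ → Set
InvertibleWith {n} T' k = Σ (Fin k → Subset n) λ X → Acyclic (invArc T' k X)

-- A cyclic triangle whose three vertices lie in exactly the same sets X i
-- survives every inversion Inv(T, X): all three of its arcs are reversed
-- the same number of times, so it is either kept or reversed as a whole.
-- It therefore suffices to build tournaments in which every family of K
-- subsets leaves some cyclic triangle homogeneous.  The 3-cycle does this
-- for K = 0, and if T does it for K then so does T[T] for K + 1: given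
-- X 0, either every block of T[T] meets X 0, and a transversal of the
-- blocks inside X 0 is a copy of T, or some block misses X 0 and is itself
-- a copy of T; in both cases X 0 is constant on that copy.
module Submission where

open import Defs
open import Data.Nat using (ℕ)
open import Data.Integer using (ℤ; +_; _<_)
open import Data.Product using (Σ)

open import Data.Bool using (Bool; true; false; not; _xor_; _∧_; T)
open import Data.Bool.Properties using (∨-zeroʳ; ¬-not) renaming (_≟_ to _≟ᵇ_)
open import Data.Empty using (⊥-elim)
open import Data.Fin using (Fin; zero; suc; combine; remQuot)
open import Data.Fin.Properties using (_≟_; remQuot-combine; combine-remQuot; all?; any?; ¬∀⟶∃¬)
open import Data.Fin.Subset using (Subset; ⊥)
open import Data.Integer using (-[1+_]; +<+; -<+)
open import Data.Nat as ℕ using (zero; suc; _*_; _≤_; _≤′_; ≤′-refl; ≤′-step)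
open import Data.Nat.Properties using (_≤?_; ≤⇒≤′; ≰⇒>)
open import Data.Product using (_×_; ∃; _,_; proj₁; proj₂; uncurry)
open import Data.Sum using (_⊎_; inj₁; inj₂)
open import Data.Unit using (tt)
open import Data.Vec using (lookup; tabulate)
open import Data.Vec.Properties using (lookup∘tabulate)
open import Data.Vec.Functional using (head; tail) renaming (_∷_ to _◂_)
open import Function using (_∘_)
open import Relation.Nullary using (¬_; Dec; yes; no)
open import Relation.Binary.PropositionalEquality
open import Relation.Binary.Construct.Closure.Transitive using ([_]; _∷_)

private
  variable
    k m n n₁ n₂ : ℕ

arc⇒≢ : (T′ : Tournament n) {x y : Fin n} → arc T′ x y ≡ true → x ≢ y
arc⇒≢ T′ {x} x→x refl with () ← trans (sym x→x) (loopless T′ x)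

someTrue? : (p : Fin n → Bool) → Dec (∃ λ b → p b ≡ true)
someTrue? p = any? (λ b → p b ≟ᵇ true)

choice-or-falseRow : (P : Fin m → Fin n → Bool) →
  (Σ (Fin m → Fin n) λ f → ∀ a → P a (f a) ≡ true) ⊎ (Σ (Fin m) λ a → ∀ b → P a b ≡ false)
choice-or-falseRow {m} P with all? (someTrue? ∘ P)
... | yes rows = inj₁ (proj₁ ∘ rows , proj₂ ∘ rows)
... | no ¬rows with a , ¬row ← ¬∀⟶∃¬ m _ (someTrue? ∘ P) ¬rows = inj₂ (a , λ b → ¬-not (¬row ∘ (b ,_)))

C₃ : Tournament 3
C₃ = record { arc = next ; loopless = next-irrefl ; oneArc = next-oneArc }
  where
  next : Fin 3 → Fin 3 → Bool
  next zero             (suc zero)       = true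
  next (suc zero)       (suc (suc zero)) = true
  next (suc (suc zero)) zero             = true
  next _                _                = false

  next-irrefl : ∀ x → next x x ≡ false
  next-irrefl zero             = refl
  next-irrefl (suc zero)       = refl
  next-irrefl (suc (suc zero)) = refl

  next-oneArc : ∀ x y → x ≢ y → next x y ≡ not (next y x)
  next-oneArc zero             zero             x≢x = ⊥-elim (x≢x refl)
  next-oneArc zero             (suc zero)       _   = refl
  next-oneArc zero             (suc (suc zero)) _   = refl
  next-oneArc (suc zero)       zero             _   = refl
  next-oneArc (suc zero)       (suc zero)       x≢x = ⊥-elim (x≢x refl)
  next-oneArc (suc zero)       (suc (suc zero)) _   = refl
  next-oneArc (suc (suc zero)) zero             _   = refl
  next-oneArc (suc (suc zero)) (suc zero)       _   = refl
  next-oneArc (suc (suc zero)) (suc (suc zero)) x≢x = ⊥-elim (x≢x refl)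

-- The lexicographic product T[U]: a copy of U (a block) for each vertex of
-- T, vertex combine a b being vertex b of block a.
module _ (T₁ : Tournament n₁) (T₂ : Tournament n₂) where

  private
    lexArc : Fin n₁ × Fin n₂ → Fin n₁ × Fin n₂ → Bool
    lexArc (a , b) (a′ , b′) with a ≟ a′
    ... | yes _ = arc T₂ b b′
    ... | no  _ = arc T₁ a a′

    lexArc-sameBlock : ∀ a b b′ → lexArc (a , b) (a , b′) ≡ arc T₂ b b′
    lexArc-sameBlock a b b′ with a ≟ a
    ... | yes _   = refl
    ... | no  a≢a = ⊥-elim (a≢a refl)

    lexArc-otherBlock : ∀ {a a′} b b′ → a ≢ a′ → lexArc (a , b) (a′ , b′) ≡ arc T₁ a a′
    lexArc-otherBlock {a} {a′} b b′ a≢a′ with a ≟ a′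
    ... | yes a≡a′ = ⊥-elim (a≢a′ a≡a′)
    ... | no  _    = refl

    lexArc-oneArc : ∀ p q → p ≢ q → lexArc p q ≡ not (lexArc q p)
    lexArc-oneArc (a , b) (a′ , b′) p≢q with a ≟ a′ | a′ ≟ a
    ... | yes refl | yes _    = oneArc T₂ b b′ (p≢q ∘ cong (a ,_))
    ... | yes a≡a′ | no  a′≢a = ⊥-elim (a′≢a (sym a≡a′))
    ... | no  a≢a′ | yes a′≡a = ⊥-elim (a≢a′ (sym a′≡a))
    ... | no  a≢a′ | no  _    = oneArc T₁ a a′ a≢a′

    remQuot-injective : {x y : Fin (n₁ * n₂)} → remQuot {n₁} n₂ x ≡ remQuot {n₁} n₂ y → x ≡ y
    remQuot-injective {x} {y} eq = begin
      x                                   ≡⟨ combine-remQuot {n₁} n₂ x ⟨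
      uncurry combine (remQuot {n₁} n₂ x) ≡⟨ cong (uncurry combine) eq ⟩
      uncurry combine (remQuot {n₁} n₂ y) ≡⟨ combine-remQuot {n₁} n₂ y ⟩
      y                                   ∎
      where open ≡-Reasoning

  _⊗_ : Tournament (n₁ * n₂)
  _⊗_ = record
    { arc      = λ x y → lexArc (remQuot {n₁} n₂ x) (remQuot {n₁} n₂ y)
    ; loopless = λ x → let a , b = remQuot {n₁} n₂ x in
                       trans (lexArc-sameBlock a b b) (loopless T₂ b)
    ; oneArc   = λ x y x≢y → lexArc-oneArc _ _ (x≢y ∘ remQuot-injective)
    }

  ⊗-arc-sameBlock : ∀ a b b′ → arc _⊗_ (combine a b) (combine a b′) ≡ arc T₂ b b′
  ⊗-arc-sameBlock a b b′ =
    trans (cong₂ lexArc (remQuot-combine {n₁} a b) (remQuot-combine {n₁} a b′)) (lexArc-sameBlock a b b′)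

  ⊗-arc-otherBlock : ∀ {a a′} b b′ → a ≢ a′ → arc _⊗_ (combine a b) (combine a′ b′) ≡ arc T₁ a a′
  ⊗-arc-otherBlock {a} {a′} b b′ a≢a′ =
    trans (cong₂ lexArc (remQuot-combine {n₁} a b) (remQuot-combine {n₁} a′ b′)) (lexArc-otherBlock b b′ a≢a′)

Inseparable : (Fin k → Subset n) → Fin n → Fin n → Set
Inseparable X x y = ∀ i → lookup (X i) x ≡ lookup (X i) y

record HomogeneousCycle (T′ : Tournament n) (X : Fin k → Subset n) : Set where
  field
    a b c : Fin n
    a→b   : arc T′ a b ≡ true
    b→c   : arc T′ b c ≡ true
    c→a   : arc T′ c a ≡ true
    a~b   : Inseparable X a b
    a~c   : Inseparable X a c

HomogeneousCycles : Tournament n → ℕ → Set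
HomogeneousCycles {n} T′ k = (X : Fin k → Subset n) → HomogeneousCycle T′ X

preimage : (Fin m → Fin n) → Subset n → Subset m
preimage g S = tabulate (λ x → lookup S (g x))

module _ {T′ : Tournament n} where

  HomogeneousCycle-tail : {X : Fin (suc k) → Subset n} →
    HomogeneousCycle T′ X → HomogeneousCycle T′ (tail X)
  HomogeneousCycle-tail C = record
    { a = a ; b = b ; c = c ; a→b = a→b ; b→c = b→c ; c→a = c→a ; a~b = a~b ∘ suc ; a~c = a~c ∘ suc }
    where open HomogeneousCycle C

  HomogeneousCycle-cons : {X : Fin (suc k) → Subset n} (s : Bool) → (∀ x → lookup (head X) x ≡ s) →
    HomogeneousCycle T′ (tail X) → HomogeneousCycle T′ X
  HomogeneousCycle-cons {X = X} s X₀≡s C = record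
    { a = a ; b = b ; c = c ; a→b = a→b ; b→c = b→c ; c→a = c→a ; a~b = a~b′ ; a~c = a~c′ }
    where
    open HomogeneousCycle C
    a~b′ : Inseparable X a b
    a~b′ zero    = trans (X₀≡s a) (sym (X₀≡s b))
    a~b′ (suc i) = a~b i
    a~c′ : Inseparable X a c
    a~c′ zero    = trans (X₀≡s a) (sym (X₀≡s c))
    a~c′ (suc i) = a~c i

  HomogeneousCycles-pred : HomogeneousCycles T′ (suc k) → HomogeneousCycles T′ k
  HomogeneousCycles-pred hom X = HomogeneousCycle-tail (hom (⊥ ◂ X))

  HomogeneousCycles-≤ : {j : ℕ} → j ≤ k → HomogeneousCycles T′ k → HomogeneousCycles T′ j
  HomogeneousCycles-≤ = go ∘ ≤⇒≤′
    where
    go : {j k : ℕ} → j ≤′ k → HomogeneousCycles T′ k → HomogeneousCycles T′ j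
    go ≤′-refl        hom = hom
    go (≤′-step j≤′k) hom = go j≤′k (HomogeneousCycles-pred hom)

HomogeneousCycle-map : {T′ : Tournament m} {U : Tournament n} {X : Fin k → Subset n}
  (g : Fin m → Fin n) → (∀ {x y} → arc T′ x y ≡ true → arc U (g x) (g y) ≡ true) →
  HomogeneousCycle T′ (preimage g ∘ X) → HomogeneousCycle U X
HomogeneousCycle-map {X = X} g g-arc C = record
  { a = g a ; b = g b ; c = g c
  ; a→b = g-arc a→b ; b→c = g-arc b→c ; c→a = g-arc c→a
  ; a~b = pushforward a~b ; a~c = pushforward a~c
  }
  where
  open HomogeneousCycle C
  pushforward : ∀ {x y} → Inseparable (preimage g ∘ X) x y → Inseparable X (g x) (g y)
  pushforward {x} {y} x~y i =
    trans (sym (lookup∘tabulate _ x)) (trans (x~y i) (lookup∘tabulate _ y))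

HomogeneousCycles-⊗ : {T₁ : Tournament n₁} {T₂ : Tournament n₂} →
  HomogeneousCycles T₁ k → HomogeneousCycles T₂ k → HomogeneousCycles (T₁ ⊗ T₂) (suc k)
HomogeneousCycles-⊗ {n₁} {n₂} {T₁ = T₁} {T₂} hom₁ hom₂ X
  with choice-or-falseRow (λ a b → lookup (head X) (combine {n₁} {n₂} a b))
... | inj₁ (f , f∈X₀) =
  HomogeneousCycle-map transversal transversal-arc
    (HomogeneousCycle-cons true (λ a → trans (lookup∘tabulate _ a) (f∈X₀ a)) (hom₁ _))
  where
  transversal : Fin n₁ → Fin (n₁ * n₂)
  transversal a = combine a (f a)
  transversal-arc : ∀ {a a′} → arc T₁ a a′ ≡ true → arc (T₁ ⊗ T₂) (transversal a) (transversal a′) ≡ true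
  transversal-arc a→a′ = trans (⊗-arc-otherBlock T₁ T₂ _ _ (arc⇒≢ T₁ a→a′)) a→a′
... | inj₂ (a , row∉X₀) =
  HomogeneousCycle-map (combine a) (λ b→b′ → trans (⊗-arc-sameBlock T₁ T₂ a _ _) b→b′)
    (HomogeneousCycle-cons false (λ b → trans (lookup∘tabulate _ b) (row∉X₀ b)) (hom₂ _))

order : ℕ → ℕ
order zero    = 3
order (suc K) = order K * order K

lexPower : (K : ℕ) → Tournament (order K)
lexPower zero    = C₃
lexPower (suc K) = lexPower K ⊗ lexPower K

HomogeneousCycles-lexPower : ∀ K → HomogeneousCycles (lexPower K) K
HomogeneousCycles-lexPower zero    X = record
  { a = zero ; b = suc zero ; c = suc (suc zero)
  ; a→b = refl ; b→c = refl ; c→a = refl ; a~b = λ () ; a~c = λ () }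
HomogeneousCycles-lexPower (suc K) =
  HomogeneousCycles-⊗ (HomogeneousCycles-lexPower K) (HomogeneousCycles-lexPower K)

oddCount-cong : (X : Fin k → Subset n) {x x′ y y′ : Fin n} →
  Inseparable X x x′ → Inseparable X y y′ → oddCount k X x y ≡ oddCount k X x′ y′
oddCount-cong {zero}  X x~x′ y~y′ = refl
oddCount-cong {suc k} X x~x′ y~y′ =
  cong₂ _xor_ (cong₂ _∧_ (x~x′ zero) (y~y′ zero)) (oddCount-cong (tail X) (x~x′ ∘ suc) (y~y′ ∘ suc))

module _ (T′ : Tournament n) (X : Fin k → Subset n) {x y : Fin n} (x→y : arc T′ x y ≡ true) where

  invArc-kept : oddCount k X x y ≡ false → invArc T′ k X x y
  invArc-kept even rewrite x→y | even = tt

  invArc-reversed : oddCount k X x y ≡ true → invArc T′ k X y x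
  invArc-reversed odd rewrite x→y | odd = subst T (sym (∨-zeroʳ _)) tt

module _ {T′ : Tournament n} {X : Fin k → Subset n} (C : HomogeneousCycle T′ X) where
  open HomogeneousCycle C

  private
    a~a : Inseparable X a a
    a~a _ = refl

    parity-uniform : ∀ {x y} → Inseparable X a x → Inseparable X a y → oddCount k X x y ≡ oddCount k X a a
    parity-uniform a~x a~y = oddCount-cong X (sym ∘ a~x) (sym ∘ a~y)

  HomogeneousCycle⇒¬Acyclic : ¬ Acyclic (invArc T′ k X)
  HomogeneousCycle⇒¬Acyclic acyclic with oddCount k X a a in parity
  ... | false = acyclic a (kept a→b a~a a~b ∷ kept b→c a~b a~c ∷ [ kept c→a a~c a~a ])
    where
    kept : ∀ {x y} → arc T′ x y ≡ true → Inseparable X a x → Inseparable X a y → invArc T′ k X x y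
    kept x→y a~x a~y = invArc-kept T′ X x→y (trans (parity-uniform a~x a~y) parity)
  ... | true = acyclic a (reversed c→a a~c a~a ∷ reversed b→c a~b a~c ∷ [ reversed a→b a~a a~b ])
    where
    reversed : ∀ {x y} → arc T′ x y ≡ true → Inseparable X a x → Inseparable X a y → invArc T′ k X y x
    reversed x→y a~x a~y = invArc-reversed T′ X x→y (trans (parity-uniform a~x a~y) parity)

HomogeneousCycles⇒index> : {T′ : Tournament n} {K : ℕ} →
  HomogeneousCycles T′ K → ∀ k → InvertibleWith T′ k → K ℕ.< k
HomogeneousCycles⇒index> {K = K} hom k (X , acyclic) with k ≤? K
... | yes k≤K = ⊥-elim (HomogeneousCycle⇒¬Acyclic (HomogeneousCycles-≤ k≤K hom X) acyclic)
... | no  k≰K = ≰⇒> k≰K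

mainTheorem17 : (m : ℤ) → Σ ℕ λ n → Σ (Tournament n) λ T →
    ((k : ℕ) → InvertibleWith T k → m < + k)
mainTheorem17 -[1+ _ ] = 3 , C₃ , λ _ _ → -<+
mainTheorem17 (+ K)    = order K , lexPower K ,
  λ k invertible → +<+ (HomogeneousCycles⇒index> (HomogeneousCycles-lexPower K) k invertible)
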